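{- Let $T\subseteq2^{<\omega}$ be a non-empty tree without maximal nodes, let $\bar c^T$ be a sequence constructed from $T$ as described in the context, and let $J$ be a non-meager ideal on $\omega$. Then $N^*_J(\bar c^T)\cap G\neq\emptyset$ for every set $G\subseteq[T]$ that is co-meager in $[T]$; i.e., $N^*_J(\bar c^T)$ is not meager in $[T]$.
   Context: An ideal on $\omega$ is a family $J\subseteq\mathcal{P}(\omega)$ closed under subsets and finite unions, containing all finite sets, with $\omega\notin J$; it is viewed as a subset of $\mathcal{P}(\omega)\cong{}^\omega2$ for "meager". $J^d=\{\omega\setminus a:a\in J\}$. For $s\in2^{<\omega}$, $[s]=\{x\in{}^\omega2:s\subseteq x\}$; $[T]$ is the set of branches of $T$. For $\bar c=\langle c_n\rangle$ with $c_n\subseteq{}^\omega2$, $N^*_J(\bar c)=\{x\in{}^\omega2:\{n:x\in c_n\}\in J^d\}$. Construction of $\bar c^T$: enumerate $T=\{t_n:n<\omega\}$ so that $t_m\subseteq t_n$ implies $m\le n$; recursively choose $t^n_k\in T$ for $k\le n$ such that $t^0_0\supseteq t_0$ and $|t^0_0|\ge1$, $t^{n+1}_{n+1}\supseteq t_{n+1}$, $t^{n+1}_k\supseteq t^n_k$ for $k\le n$, and $|t^{n+1}_k|\ge 2n+2$ for $k\le n+1$. Put $c^T_n=\bigcup_{k\le n}[t^n_k]$ and $\bar c^T=\langle c^T_n:n<\omega\rangle$. -}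

module Defs where

open import Data.Nat using (ℕ; zero; suc; _+_; _*_; _≤_; _<_)
open import Data.Bool using (Bool; true; false)
open import Data.List using (List; []; _∷_; _++_; length)
open import Data.Product using (Σ; ∃; _×_; _,_)
open import Data.Unit using (⊤)
open import Relation.Nullary using (¬_)
open import Relation.Binary.PropositionalEquality using (_≡_)

-- Cantor space 2^ω, also used for P(ω) (characteristic functions)
Cantor : Set
Cantor = ℕ → Bool

Str : Set
Str = List Bool

_↾_ : Cantor → ℕ → Str
x ↾ zero = []
x ↾ suc n = x zero ∷ ((λ i → x (suc i)) ↾ n)

_⊑_ : Str → Str → Set
s ⊑ t = ∃ λ u → s ++ u ≡ t

_≺_ : Str → Cantor → Set
s ≺ x = x ↾ length s ≡ s

IsTree : (Str → Set) → Set
IsTree T = ∀ s t → T t → s ⊑ t → T s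

NonEmpty : (Str → Set) → Set
NonEmpty T = ∃ λ s → T s

NoMaximal : (Str → Set) → Set
NoMaximal T = ∀ t → T t → ∃ λ t' → T t' × t ⊑ t' × length t < length t'

Branches : (Str → Set) → Cantor → Set
Branches T x = ∀ n → T (x ↾ n)

FullTree : Str → Set
FullTree _ = ⊤

NowhereDenseIn : (Str → Set) → (Cantor → Set) → Set
NowhereDenseIn T A =
  ∀ s → T s → ∃ λ t → T t × s ⊑ t × (∀ x → Branches T x → t ≺ x → ¬ A x)

MeagerIn : (Str → Set) → (Cantor → Set) → Set₁
MeagerIn T A = Σ (ℕ → Cantor → Set) λ D →
  (∀ n → NowhereDenseIn T (D n)) × (∀ x → Branches T x → A x → ∃ λ n → D n x)

Meager : (Cantor → Set) → Set₁
Meager = MeagerIn FullTree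

_⊆ω_ : Cantor → Cantor → Set
a ⊆ω b = ∀ n → a n ≡ true → b n ≡ true

_∪ω_ : Cantor → Cantor → Cantor
(a ∪ω b) n with a n
... | true = true
... | false = b n

FiniteSet : Cantor → Set
FiniteSet a = ∃ λ N → ∀ n → N ≤ n → a n ≡ false

record IsIdeal (J : Cantor → Set) : Set where
  field
    downward : ∀ a b → a ⊆ω b → J b → J a
    unions   : ∀ a b → J a → J b → J (a ∪ω b)
    finites  : ∀ a → FiniteSet a → J a
    proper   : ¬ J (λ _ → true)

cT : (ℕ → ℕ → Str) → ℕ → Cantor → Set
cT tt n x = ∃ λ k → k ≤ n × tt n k ≺ x

-- N*_J(c̄) = {x : {n : x ∈ c_n} ∈ J^d},
-- i.e. {n : x ∈ c_n} = ω ∖ a for some a ∈ J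
NStar : (Cantor → Set) → (ℕ → Cantor → Set) → Cantor → Set
NStar J c x = ∃ λ a → J a × (∀ n → (c n x → a n ≡ false) × (a n ≡ false → c n x))

IsEnum : (Str → Set) → (ℕ → Str) → Set
IsEnum T e = (∀ n → T (e n)) × (∀ t → T t → ∃ λ n → e n ≡ t)
           × (∀ m n → e m ⊑ e n → m ≤ n)

-- tt n k = t^n_k (only k ≤ n is relevant) satisfies the recursion conditions
IsChoice : (Str → Set) → (ℕ → Str) → (ℕ → ℕ → Str) → Set
IsChoice T e tt =
    (∀ n k → k ≤ n → T (tt n k))
  × (e 0 ⊑ tt 0 0) × (1 ≤ length (tt 0 0))
  × (∀ n → e (suc n) ⊑ tt (suc n) (suc n))
  × (∀ n k → k ≤ n → tt n k ⊑ tt (suc n) k)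
  × (∀ n k → k ≤ suc n → 2 * n + 2 ≤ length (tt (suc n) k))

{-# OPTIONS --safe #-}
module Submission where

-- Given a cover of N*_J(c̄^T) ∩ [T] by nowhere dense sets D_i, we build a
-- continuous map branch : 2^ω → [T] whose preimages of the D_i are nowhere
-- dense and which sends every a ∈ J into N*_J(c̄^T); then J would be meager.
-- The branch of a runs down one column k of the array t^n_k while a n = 0,
-- so it lies in c^T_n whenever n ∉ a.  A block of m + 1 ones right after
-- stage n, where e m extends t^n_k and avoids D_0, …, D_n, makes it jump to
-- e m and then follow column m.  Any finite string σ can be extended by zeros
-- followed by such a block, which forces branch a out of D_i.

open import Defs
open import Data.Nat using (ℕ; zero; suc; _+_; _*_; _≤_; _<_; _≤′_; ≤′-refl; ≤′-step; z≤n; s≤s; _≤?_)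
open import Data.Nat.Properties
open import Data.Bool using (Bool; true; false; _∧_)
open import Data.Bool.Properties using (∧-conicalʳ) renaming (_≟_ to _≟ᵇ_)
open import Data.List using ([]; _∷_; _++_; length; replicate)
open import Data.List.Properties using (++-assoc; ++-identityʳ; length-++; length-replicate; ∷-injective; ≡-dec)
open import Data.Product using (Σ; ∃; _×_; _,_; proj₁; proj₂)
open import Data.Sum using (inj₁; inj₂)
open import Data.Empty using (⊥-elim)
open import Relation.Nullary using (¬_; Dec; yes; no)
open import Relation.Nullary.Decidable using (isNo; map′)
open import Relation.Binary.PropositionalEquality

bit : Str → ℕ → Bool
bit []      _       = false
bit (b ∷ _) zero    = b
bit (_ ∷ s) (suc q) = bit s q

≺⇒bit : ∀ s x → s ≺ x → ∀ q → q < length s → x q ≡ bit s q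
≺⇒bit (b ∷ s) x s≺x zero    _         = proj₁ (∷-injective s≺x)
≺⇒bit (b ∷ s) x s≺x (suc q) (s≤s q<s) = ≺⇒bit s (λ i → x (suc i)) (proj₂ (∷-injective s≺x)) q q<s

bit⇒≺ : ∀ s x → (∀ q → q < length s → x q ≡ bit s q) → s ≺ x
bit⇒≺ []      x _     = refl
bit⇒≺ (b ∷ s) x agree =
  cong₂ _∷_ (agree zero (s≤s z≤n)) (bit⇒≺ s (λ i → x (suc i)) (λ q q<s → agree (suc q) (s≤s q<s)))

bit-++ˡ : ∀ s u q → q < length s → bit (s ++ u) q ≡ bit s q
bit-++ˡ (b ∷ s) u zero    _         = refl
bit-++ˡ (b ∷ s) u (suc q) (s≤s q<s) = bit-++ˡ s u q q<s

bit-++ʳ : ∀ s u q → bit (s ++ u) (length s + q) ≡ bit u q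
bit-++ʳ []      u q = refl
bit-++ʳ (b ∷ s) u q = bit-++ʳ s u q

bit-replicate : ∀ n b q → q < n → bit (replicate n b) q ≡ b
bit-replicate (suc n) b zero    _         = refl
bit-replicate (suc n) b (suc q) (s≤s q<n) = bit-replicate n b q q<n

⊑-refl : ∀ {s} → s ⊑ s
⊑-refl {s} = [] , ++-identityʳ s

⊑-trans : ∀ {s t r} → s ⊑ t → t ⊑ r → s ⊑ r
⊑-trans {s} (u , refl) (v , refl) = u ++ v , sym (++-assoc s u v)

⊑⇒length≤ : ∀ {s t} → s ⊑ t → length s ≤ length t
⊑⇒length≤ {s} (u , refl) = ≤-trans (m≤m+n (length s) (length u)) (≤-reflexive (sym (length-++ s)))

⊑⇒bit≡ : ∀ {s t} → s ⊑ t → ∀ q → q < length s → bit s q ≡ bit t q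
⊑⇒bit≡ {s} (u , refl) q q<s = sym (bit-++ˡ s u q q<s)

⊑-≺-trans : ∀ {s t x} → s ⊑ t → t ≺ x → s ≺ x
⊑-≺-trans {s} {t} {x} s⊑t t≺x = bit⇒≺ s x λ q q<s →
  trans (≺⇒bit t x t≺x q (<-≤-trans q<s (⊑⇒length≤ s⊑t))) (sym (⊑⇒bit≡ s⊑t q q<s))

↾-mono : ∀ x {m n} → m ≤ n → (x ↾ m) ⊑ (x ↾ n)
↾-mono x {zero}  {n}     _       = x ↾ n , refl
↾-mono x {suc m} {suc n} (s≤s m≤n) with ↾-mono (λ i → x (suc i)) m≤n
... | u , eq = u , cong (x zero ∷_) eq

↾⊑ : ∀ x n s → n ≤ length s → s ≺ x → (x ↾ n) ⊑ s
↾⊑ x n s n≤s s≺x = subst ((x ↾ n) ⊑_) s≺x (↾-mono x n≤s)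

≺-replicateʳ : ∀ s l b x → (s ++ replicate l b) ≺ x → ∀ j → j < l → x (length s + j) ≡ b
≺-replicateʳ s l b x s++bˡ≺x j j<l = begin
  x (length s + j)                    ≡⟨ ≺⇒bit (s ++ replicate l b) x s++bˡ≺x _ in-range ⟩
  bit (s ++ replicate l b) (length s + j) ≡⟨ bit-++ʳ s (replicate l b) j ⟩
  bit (replicate l b) j               ≡⟨ bit-replicate l b j j<l ⟩
  b                                   ∎
  where
  open ≡-Reasoning
  in-range : length s + j < length (s ++ replicate l b)
  in-range = subst (length s + j <_) (sym (trans (length-++ s) (cong (length s +_) (length-replicate l))))
                   (+-monoʳ-< (length s) j<l)

≺? : ∀ s x → Dec (s ≺ x)
≺? s x = ≡-dec _≟ᵇ_ (x ↾ length s) s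

cT? : ∀ tt n x → Dec (cT tt n x)
cT? tt n x = map′ (λ { (k , s≤s k≤n , t≺x) → k , k≤n , t≺x })
                  (λ { (k , k≤n , t≺x) → k , s≤s k≤n , t≺x })
                  (anyUpTo? (λ k → ≺? (tt n k) x) (suc n))

onesFrom : Cantor → ℕ → ℕ → Bool
onesFrom a s zero    = true
onesFrom a s (suc l) = a s ∧ onesFrom a (suc s) l

onesFrom-intro : ∀ a s l → (∀ j → j < l → a (s + j) ≡ true) → onesFrom a s l ≡ true
onesFrom-intro a s zero    _    = refl
onesFrom-intro a s (suc l) ones = cong₂ _∧_ head (onesFrom-intro a (suc s) l tail)
  where
  head : a s ≡ true
  head = subst (λ q → a q ≡ true) (+-identityʳ s) (ones 0 (s≤s z≤n))
  tail : ∀ j → j < l → a (suc s + j) ≡ true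
  tail j j<l = subst (λ q → a q ≡ true) (+-suc s j) (ones (suc j) (s≤s j<l))

-- A run of ones starting at or before M cannot see past the zero at M.
onesFrom-agree : ∀ a b M → (∀ q → q ≤ M → a q ≡ b q) → a M ≡ false →
                 ∀ s l → s ≤ M → onesFrom a s l ≡ onesFrom b s l
onesFrom-agree a b M agree aM s zero    _   = refl
onesFrom-agree a b M agree aM s (suc l) s≤M with m≤n⇒m<n∨m≡n s≤M
... | inj₁ s<M = cong₂ _∧_ (agree s s≤M) (onesFrom-agree a b M agree aM (suc s) l s<M)
... | inj₂ refl = trans (cong (_∧ onesFrom a (suc s) l) aM)
                        (sym (cong (_∧ onesFrom b (suc s) l) (trans (sym (agree s ≤-refl)) aM)))

isNo≡false⇒ : ∀ {P : Set} (P? : Dec P) → isNo P? ≡ false → P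
isNo≡false⇒ (yes p) _ = p

⇒isNo≡false : ∀ {P : Set} (P? : Dec P) → P → isNo P? ≡ false
⇒isNo≡false (yes _) _ = refl
⇒isNo≡false (no ¬p) p = ⊥-elim (¬p p)

NStar-intro : ∀ J → IsIdeal J → (c : ℕ → Cantor → Set) → ∀ {x} → (∀ n → Dec (c n x)) →
              ∀ {a} → J a → (∀ n → a n ≡ false → c n x) → NStar J c x
NStar-intro J ideal c {x} c? {a} a∈J outside-a =
  miss , IsIdeal.downward ideal miss a miss⊆a a∈J , λ n → ⇒isNo≡false (c? n) , isNo≡false⇒ (c? n)
  where
  miss : Cantor
  miss n = isNo (c? n)
  miss⊆a : miss ⊆ω a
  miss⊆a n miss-n with a n in eq
  ... | true  = refl
  ... | false with c? n
  ...   | yes _ = miss-n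
  ...   | no x∉cₙ = ⊥-elim (x∉cₙ (outside-a n eq))

AvoidsUpTo : (Str → Set) → (ℕ → Cantor → Set) → ℕ → Str → Set
AvoidsUpTo T D n v = ∀ i → i ≤ n → ∀ x → Branches T x → v ≺ x → ¬ D i x

extend-avoiding : ∀ T D → (∀ i → NowhereDenseIn T (D i)) →
                  ∀ n u → T u → ∃ λ v → T v × u ⊑ v × AvoidsUpTo T D n v
extend-avoiding T D nd zero u u∈T with nd zero u u∈T
... | v , v∈T , u⊑v , avoids = v , v∈T , u⊑v , λ { zero _ → avoids }
extend-avoiding T D nd (suc n) u u∈T with extend-avoiding T D nd n u u∈T
... | v , v∈T , u⊑v , avoidsₙ with nd (suc n) v v∈T
...   | w , w∈T , v⊑w , avoids = w , w∈T , ⊑-trans u⊑v v⊑w , avoidsₙ₊₁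
  where
  avoidsₙ₊₁ : AvoidsUpTo T D (suc n) w
  avoidsₙ₊₁ i i≤n+1 x x∈[T] w≺x with m≤n⇒m<n∨m≡n i≤n+1
  ... | inj₁ i<n+1 = avoidsₙ i (≤-pred i<n+1) x x∈[T] (⊑-≺-trans v⊑w w≺x)
  ... | inj₂ refl  = avoids x x∈[T] w≺x
  
-- At stage n, heading m d means the branch has left its column for t^{n+d+1}_m
-- and rejoins column m at stage n + d + 1.
data Phase : Set where
  follow  : ℕ → Phase
  heading : ℕ → ℕ → Phase

module Construction (T : Str → Set) (isTree : IsTree T) (e : ℕ → Str) (enum : IsEnum T e)
                    (tt : ℕ → ℕ → Str) (choice : IsChoice T e tt)
                    (D : ℕ → Cantor → Set) (nowhereDense : ∀ i → NowhereDenseIn T (D i)) where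

  tt∈T : ∀ n k → k ≤ n → T (tt n k)
  tt∈T = proj₁ choice

  column-step : ∀ n k → k ≤ n → tt n k ⊑ tt (suc n) k
  column-step = proj₁ (proj₂ (proj₂ (proj₂ (proj₂ choice))))

  e⊑diagonal : ∀ m → e m ⊑ tt m m
  e⊑diagonal zero    = proj₁ (proj₂ choice)
  e⊑diagonal (suc m) = proj₁ (proj₂ (proj₂ (proj₂ choice))) m

  column-mono : ∀ {k n n′} → k ≤ n → n ≤′ n′ → tt n k ⊑ tt n′ k
  column-mono k≤n ≤′-refl            = ⊑-refl
  column-mono k≤n (≤′-step n≤′n′) =
    ⊑-trans (column-mono k≤n n≤′n′) (column-step _ _ (≤-trans k≤n (≤′⇒≤ n≤′n′)))

  length-tt : ∀ {n k q} → k ≤ n → q ≤ n → suc q ≤ length (tt n k)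
  length-tt {zero}  z≤n z≤n = proj₁ (proj₂ (proj₂ choice))
  length-tt {suc n} {k} {q} k≤n q≤n = ≤-trans (s≤s q≤n) (≤-trans 2+n≤2n+2 (long n k k≤n))
    where
    long : ∀ n k → k ≤ suc n → 2 * n + 2 ≤ length (tt (suc n) k)
    long = proj₂ (proj₂ (proj₂ (proj₂ (proj₂ choice))))
    2+n≤2n+2 : 2 + n ≤ 2 * n + 2
    2+n≤2n+2 = ≤-trans (s≤s (s≤s (m≤m+n n (n + 0)))) (≤-reflexive (+-comm 2 (2 * n)))

  escape : ∀ n k → Σ ℕ λ m → k ≤ n → tt n k ⊑ e m × AvoidsUpTo T D n (e m)
  escape n k with k ≤? n
  ... | no k≰n = 0 , λ k≤n → ⊥-elim (k≰n k≤n)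
  ... | yes k≤n with extend-avoiding T D nowhereDense n (tt n k) (tt∈T n k k≤n)
  ...   | v , v∈T , tt⊑v , avoids with proj₁ (proj₂ enum) v v∈T
  ...     | m , refl = m , λ _ → tt⊑v , avoids

  target : ℕ → ℕ → ℕ
  target n k = proj₁ (escape n k)

  followOrJump : Bool → ℕ → ℕ → Phase
  followOrJump true  n k = heading (target n k) (target n k)
  followOrJump false n k = follow k

  step : Cantor → ℕ → Phase → Phase
  step a n (follow k)          = followOrJump (onesFrom a (suc n) (suc (target n k))) n k
  step a n (heading m zero)    = follow m
  step a n (heading m (suc d)) = heading m d

  phase : Cantor → ℕ → Phase
  phase a zero    = follow zero
  phase a (suc n) = step a n (phase a n)

  node : ℕ → Phase → Str
  node n (follow k)    = tt n k
  node n (heading m d) = tt (suc d + n) m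

  Valid : Cantor → ℕ → Phase → Set
  Valid a n (follow k)    = k ≤ n
  Valid a n (heading m d) = m ≤ suc d + n × onesFrom a n (suc d) ≡ true

  step-valid : ∀ a n p → Valid a n p → Valid a (suc n) (step a n p)
  step-valid a n (follow k) k≤n = valid-after (onesFrom a (suc n) (suc (target n k))) refl
    where
    valid-after : ∀ b → onesFrom a (suc n) (suc (target n k)) ≡ b → Valid a (suc n) (followOrJump b n k)
    valid-after true  ones = ≤-trans (n≤1+n _) (m≤m+n _ (suc n)) , ones
    valid-after false _    = m≤n⇒m≤1+n k≤n
  step-valid a n (heading m zero)    (m≤ , _)    = m≤
  step-valid a n (heading m (suc d)) (m≤ , ones) =
    subst (m ≤_) (sym (+-suc (suc d) n)) m≤ , ∧-conicalʳ (a n) _ ones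

  valid : ∀ a n → Valid a n (phase a n)
  valid a zero    = z≤n
  valid a (suc n) = step-valid a n (phase a n) (valid a n)

  node∈T : ∀ a n p → Valid a n p → T (node n p)
  node∈T a n (follow k)    k≤n      = tt∈T n k k≤n
  node∈T a n (heading m d) (m≤ , _) = tt∈T _ m m≤

  length-node : ∀ a n p → Valid a n p → suc n ≤ length (node n p)
  length-node a n (follow k)    k≤n      = length-tt k≤n ≤-refl
  length-node a n (heading m d) (m≤ , _) = length-tt m≤ (m≤n+m n (suc d))

  e⊑jump-node : ∀ m n → e m ⊑ node n (heading m m)
  e⊑jump-node m n = ⊑-trans (e⊑diagonal m) (column-mono ≤-refl (≤⇒≤′ (≤-trans (n≤1+n m) (m≤m+n (suc m) n))))

  step-extends : ∀ a n p → Valid a n p → node n p ⊑ node (suc n) (step a n p)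
  step-extends a n (follow k) k≤n = extends (onesFrom a (suc n) (suc (target n k)))
    where
    extends : ∀ b → tt n k ⊑ node (suc n) (followOrJump b n k)
    extends true  = ⊑-trans (proj₁ (proj₂ (escape n k) k≤n)) (e⊑jump-node (target n k) (suc n))
    extends false = column-step n k k≤n
  step-extends a n (heading m zero)    _ = ⊑-refl
  step-extends a n (heading m (suc d)) _ = subst (λ j → node n (heading m (suc d)) ⊑ tt j m) (sym (+-suc (suc d) n)) ⊑-refl

  path : Cantor → ℕ → Str
  path a n = node n (phase a n)

  path-mono : ∀ a {n n′} → n ≤′ n′ → path a n ⊑ path a n′
  path-mono a ≤′-refl             = ⊑-refl
  path-mono a (≤′-step {n′} n≤′n′) =
    ⊑-trans (path-mono a n≤′n′) (step-extends a n′ (phase a n′) (valid a n′))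

  branch : Cantor → Cantor
  branch a q = bit (path a q) q

  path-≺-branch : ∀ a n → path a n ≺ branch a
  path-≺-branch a n = bit⇒≺ (path a n) (branch a) agree
    where
    long-enough : ∀ q → q < length (path a q)
    long-enough q = length-node a q (phase a q) (valid a q)
    agree : ∀ q → q < length (path a n) → branch a q ≡ bit (path a n) q
    agree q q<n with q ≤? n
    ... | yes q≤n = ⊑⇒bit≡ (path-mono a (≤⇒≤′ q≤n)) q (long-enough q)
    ... | no  q≰n = sym (⊑⇒bit≡ (path-mono a (≤⇒≤′ (≰⇒≥ q≰n))) q q<n)

  branch∈[T] : ∀ a → Branches T (branch a)
  branch∈[T] a n = isTree _ (path a n) (node∈T a n (phase a n) (valid a n))
    (↾⊑ (branch a) n (path a n) (≤-trans (n≤1+n n) (length-node a n (phase a n) (valid a n))) (path-≺-branch a n))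

  zero⇒follow : ∀ a n p → Valid a n p → a n ≡ false → ∃ λ k → p ≡ follow k × k ≤ n
  zero⇒follow a n (follow k)    k≤n       _  = k , refl , k≤n
  zero⇒follow a n (heading m d) (_ , ones) aₙ with () ← subst (λ b → b ∧ onesFrom a (suc n) d ≡ true) aₙ ones

  branch∈cT : ∀ a n → a n ≡ false → cT tt n (branch a)
  branch∈cT a n aₙ with zero⇒follow a n (phase a n) (valid a n) aₙ
  ... | k , eq , k≤n = k , k≤n , subst (λ p → node n p ≺ branch a) eq (path-≺-branch a n)

  phase-agree : ∀ a b M → (∀ q → q ≤ M → a q ≡ b q) → a M ≡ false →
                ∀ n → n ≤ M → phase a n ≡ phase b n
  phase-agree a b M agree aM zero    _     = refl
  phase-agree a b M agree aM (suc n) n+1≤M =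
    trans (cong (step a n) (phase-agree a b M agree aM n (≤-trans (n≤1+n n) n+1≤M))) (same-step (phase b n))
    where
    same-step : ∀ p → step a n p ≡ step b n p
    same-step (follow k) =
      cong (λ b → followOrJump b n k) (onesFrom-agree a b M agree aM (suc n) (suc (target n k)) n+1≤M)
    same-step (heading m zero)    = refl
    same-step (heading m (suc d)) = refl

  forced-escape : ∀ a n k → phase a n ≡ follow k → onesFrom a (suc n) (suc (target n k)) ≡ true →
                  ∀ i → i ≤ n → ¬ D i (branch a)
  forced-escape a n k phaseₙ ones i i≤n =
    proj₂ (proj₂ (escape n k) k≤n) i i≤n (branch a) (branch∈[T] a) (⊑-≺-trans e⊑path (path-≺-branch a (suc n)))
    where
    k≤n : k ≤ n
    k≤n = subst (λ p → Valid a n p) phaseₙ (valid a n)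
    e⊑path : e (target n k) ⊑ path a (suc n)
    e⊑path rewrite phaseₙ | ones = e⊑jump-node (target n k) (suc n)

  -- The zero at stage M ≥ i pins the phase at M for every extension of τ.
  preimage-nowhereDense : ∀ i → NowhereDenseIn FullTree (λ a → D i (branch a))
  preimage-nowhereDense i σ _ = τ , _ , σ⊑τ , escapes
    where
    M : ℕ
    M = length σ + i
    σ′ : Str
    σ′ = σ ++ replicate (suc i) false
    a₀ : Cantor
    a₀ = bit σ′
    length-σ′ : length σ′ ≡ suc M
    length-σ′ = trans (length-++ σ) (trans (cong (length σ +_) (length-replicate (suc i))) (+-suc (length σ) i))
    a₀M : a₀ M ≡ false
    a₀M = trans (bit-++ʳ σ (replicate (suc i) false) i) (bit-replicate (suc i) false i ≤-refl)
    pinned : ∃ λ k → phase a₀ M ≡ follow k × k ≤ M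
    pinned = zero⇒follow a₀ M (phase a₀ M) (valid a₀ M) a₀M
    k : ℕ
    k = proj₁ pinned
    m : ℕ
    m = target M k
    τ : Str
    τ = σ′ ++ replicate (suc m) true
    σ⊑τ : σ ⊑ τ
    σ⊑τ = replicate (suc i) false ++ replicate (suc m) true , sym (++-assoc σ _ _)
    escapes : ∀ a → Branches FullTree a → τ ≺ a → ¬ D i (branch a)
    escapes a _ τ≺a = forced-escape a M k phaseM ones i (m≤n+m i (length σ))
      where
      agree : ∀ q → q ≤ M → a q ≡ a₀ q
      agree q q≤M = ≺⇒bit σ′ a (⊑-≺-trans (_ , refl) τ≺a) q (subst (q <_) (sym length-σ′) (s≤s q≤M))
      phaseM : phase a M ≡ follow k
      phaseM = trans (phase-agree a a₀ M agree (trans (agree M ≤-refl) a₀M) M ≤-refl) (proj₁ (proj₂ pinned))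
      ones : onesFrom a (suc M) (suc m) ≡ true
      ones = onesFrom-intro a (suc M) (suc m) λ j j<m+1 →
        subst (λ s → a (s + j) ≡ true) length-σ′ (≺-replicateʳ σ′ (suc m) true a τ≺a j j<m+1)

-- Non-emptiness and the absence of maximal nodes are only needed for the
-- enumeration and the choice ⟨t^n_k⟩ to exist; here both are given.
lemma3p9 : (T : Str → Set) → IsTree T → NonEmpty T → NoMaximal T →
           (e : ℕ → Str) → IsEnum T e →
           (tt : ℕ → ℕ → Str) → IsChoice T e tt →
           (J : Cantor → Set) → IsIdeal J → ¬ Meager J →
           ¬ MeagerIn T (NStar J (cT tt))
lemma3p9 T isTree _ _ e enum tt choice J ideal J-nonMeager (D , nowhereDense , covers) =
  J-nonMeager ((λ i a → D i (branch a)) , preimage-nowhereDense , covered)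
  where
  open Construction T isTree e enum tt choice D nowhereDense
  covered : ∀ a → Branches FullTree a → J a → ∃ λ i → D i (branch a)
  covered a _ a∈J = covers (branch a) (branch∈[T] a) (NStar-intro J ideal (cT tt) (λ n → cT? tt n (branch a)) a∈J (branch∈cT a))
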